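{- Let $p\ge2$ and $s\ge1$ be integers and let $(\mathbf{d},\mathbf{r})$ be an arithmetical structure on $\mathcal{CT}(p,s)$. If $d_i=1$ for some $1\le i\le p-1$, then the pair $(\mathbf{d}',\mathbf{r}')$ resulting from smoothing at the vertex $v_i$ is an arithmetical structure on $\mathcal{CT}(p-1,s)$.
   Context: The coconut tree $\mathcal{CT}(p,s)$ ($p\ge1$, $s\ge0$) is the graph with vertices $v_1,\dots,v_p,v_{\ell_1},\dots,v_{\ell_s}$ and edges $v_iv_{i+1}$ ($1\le i\le p-1$) and $v_pv_{\ell_j}$ ($1\le j\le s$). An arithmetical structure on a finite connected simple graph is a pair $(\mathbf{d},\mathbf{r})$ of vectors of positive integers indexed by the vertices such that for every vertex $v$, $d_vr_v$ equals the sum of $r_u$ over the neighbors $u$ of $v$, and the entries of $\mathbf{r}$ have gcd $1$. On $\mathcal{CT}(p,s)$ write $\mathbf{r}=(r_1,\dots,r_p,r_{\ell_1},\dots,r_{\ell_s})$ and similarly for $\mathbf{d}$. Smoothing at $v_i$ for $2\le i\le p-1$ (when $d_i=1$) produces vectors on $\mathcal{CT}(p-1,s)$: $r'_j=r_j$ for $j\in\{1,\dots,i-1,\ell_1,\dots,\ell_s\}$, $r'_j=r_{j+1}$ for $j\in\{i,\dots,p-1\}$; $d'_j=d_j$ for $j\in\{1,\dots,i-2,\ell_1,\dots,\ell_s\}$, $d'_{i-1}=d_{i-1}-1$, $d'_i=d_{i+1}-1$, $d'_j=d_{j+1}$ for $j\in\{i+1,\dots,p-1\}$. Smoothing at $v_1$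 (when $d_1=1$, $p\ge2$) produces vectors on $\mathcal{CT}(p-1,s)$: $r'_j=r_{j+1}$ for $1\le j\le p-1$, $r'_{\ell_k}=r_{\ell_k}$; $d'_1=d_2-1$, $d'_j=d_{j+1}$ for $2\le j\le p-1$, $d'_{\ell_k}=d_{\ell_k}$. -}

module Defs where

open import Data.Nat using (ℕ; zero; suc; _+_; _*_; _∸_; _<_; _≤_; pred)
open import Data.Nat.Properties using (_≟_; _<?_; _≤?_)
open import Data.Nat.GCD using (gcd)
open import Data.Bool using (Bool; true; false; _∧_; _∨_; if_then_else_)
open import Data.Fin using (Fin; toℕ; fromℕ<)
open import Data.List using (List; map; foldr; allFin)
open import Data.Nat.ListAction using (sum)
open import Relation.Nullary using (yes; no)
open import Relation.Nullary.Decidable using (⌊_⌋)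
open import Relation.Binary.PropositionalEquality using (_≡_)

neighbourSum : ∀ {n} → (Fin n → Fin n → Bool) → (Fin n → ℕ) → Fin n → ℕ
neighbourSum adj r v = sum (map (λ u → if adj v u then r u else 0) (allFin _))

gcdAll : ∀ {n} → (Fin n → ℕ) → ℕ
gcdAll {n} r = foldr (λ u g → gcd (r u) g) 0 (allFin n)

record IsArithmetical {n : ℕ} (adj : Fin n → Fin n → Bool) (d r : Fin n → ℕ) : Set where
  field
    d-pos   : ∀ v → 1 ≤ d v
    r-pos   : ∀ v → 1 ≤ r v
    balance : ∀ v → d v * r v ≡ neighbourSum adj r v
    r-gcd   : gcdAll r ≡ 1

-- Coconut tree CT(p,s) on vertex set Fin (p + s) (0-based indices):
-- index k < p is the path vertex v_{k+1}; index p + j is the leaf v_{ℓ_{j+1}}.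
-- Edges: {k, k+1} for k + 1 < p (i.e. v_{k+1} v_{k+2}), and {p-1, p+j}
-- (i.e. v_p v_{ℓ_{j+1}}) for every leaf.
ctAdj₀ : ℕ → ℕ → ℕ → Bool
ctAdj₀ p a b = (⌊ suc a ≟ b ⌋ ∧ ⌊ b <? p ⌋) ∨ (⌊ suc a ≟ p ⌋ ∧ ⌊ p ≤? b ⌋)

CT : (p s : ℕ) → Fin (p + s) → Fin (p + s) → Bool
CT p s u v = ctAdj₀ p (toℕ u) (toℕ v) ∨ ctAdj₀ p (toℕ v) (toℕ u)

-- Total lookup at a natural-number index (0 if out of range; never used
-- out of range below).
at : ∀ {n} → (Fin n → ℕ) → ℕ → ℕ
at {n} f k with k <? n
... | yes k<n = f (fromℕ< k<n)
... | no _ = 0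

-- Smoothing at the path vertex v_{i+1} (0-based index i, 0 ≤ i ≤ p-2),
-- producing vectors on CT(p-1,s), indexed by Fin (pred p + s).
-- The new vertex with 0-based index k corresponds to old index k if k < i,
-- and to old index k+1 otherwise (the old vertex i is deleted; leaves shift).
smoothR : (p s i : ℕ) → (Fin (p + s) → ℕ) → Fin (pred p + s) → ℕ
smoothR p s i r k with toℕ k <? i
... | yes _ = at r (toℕ k)
... | no  _ = at r (suc (toℕ k))

-- d'_k = d_k for k < i-1; d'_{i-1} = d_{i-1} - 1; d'_i = d_{i+1} - 1;
-- d'_k = d_{k+1} for k > i (0-based; leaves included in the last case).
smoothD : (p s i : ℕ) → (Fin (p + s) → ℕ) → Fin (pred p + s) → ℕ
smoothD p s i d k with suc (toℕ k) <? i | suc (toℕ k) ≟ i | toℕ k ≟ i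
... | yes _ | _     | _     = at d (toℕ k)
... | no _  | yes _ | _     = at d (toℕ k) ∸ 1
... | no _  | no _  | yes _ = at d (suc (toℕ k)) ∸ 1
... | no _  | no _  | no _  = at d (suc (toℕ k))

-- Read r and d as sequences R, D on 0-based indices, with hub index h = p - 1. On CT(h+1, s) the
-- balance equations say D_a R_a = R_(a-1) + R_(a+1) on the path (a < h), D_h R_h = R_(h-1) plus the
-- leaf values at the hub, and D_ℓ R_ℓ = R_h at a leaf ℓ. Because D_i = 1 we have
-- R_i = R_(i-1) + R_(i+1), so after deleting vertex i the equations at its two path neighbours still
-- hold once R_i is subtracted from both sides, i.e. once their D drops by one; every other equation
-- is only re-indexed. Every entry of r' is an entry of r, so r' is positive and hence so is every
-- neighbour sum, forcing d' > 0; and every entry of r is a sum of at most two entries of r', so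
-- gcd(r') divides gcd(r) = 1.
module Submission where

open import Defs
open import Data.Nat using (ℕ; zero; suc; _+_; _*_; _∸_; _≤_; _<_; pred; z≤n; s≤s; z<s; s<s; >-nonZero; >-nonZero⁻¹)
open import Data.Nat.Properties
open import Data.Nat.Divisibility using (_∣_; _∣0; ∣-trans; ∣1⇒≡1; ∣m∣n⇒∣m+n)
open import Data.Nat.GCD using (gcd; gcd[m,n]∣m; gcd[m,n]∣n; gcd-greatest)
open import Data.Nat.ListAction using (sum)
open import Data.Bool using (true; false; T; _∧_; _∨_; if_then_else_)
open import Data.Bool.Properties using (T-∨; T-∧)
open import Data.Fin using (Fin; toℕ; fromℕ<)
import Data.Fin as Fin
open import Data.Fin.Properties using (fromℕ<-toℕ; toℕ-fromℕ<; toℕ<n)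
open import Data.List using ([]; _∷_; foldr; allFin; tabulate)
open import Data.List.Properties using (map-tabulate)
open import Data.List.Relation.Unary.Any using (here; there)
open import Data.List.Membership.Propositional using (_∈_)
open import Data.List.Membership.Propositional.Properties using (∈-allFin)
open import Data.Product using (_,_)
open import Data.Sum using (_⊎_; inj₁; inj₂; [_,_])
import Data.Sum as Sum
open import Data.Unit using (tt)
open import Function using (_∘_; id; Equivalence)
open import Algebra.Properties.CommutativeSemigroup +-commutativeSemigroup using (xy∙z≈xz∙y)
open import Relation.Nullary using (¬_; yes; no; contradiction)
open import Relation.Nullary.Decidable using (⌊_⌋; toWitness; fromWitness)
open import Relation.Binary.Definitions using (tri<; tri≈; tri>)
open import Relation.Binary.PropositionalEquality
  using (_≡_; _≢_; refl; sym; trans; cong; cong₂; subst; module ≡-Reasoning)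

open Equivalence using (to; from)

sumBelow : ℕ → (ℕ → ℕ) → ℕ
sumBelow zero    f = 0
sumBelow (suc n) f = f 0 + sumBelow n (f ∘ suc)

sumBelow-cong : ∀ n {f g : ℕ → ℕ} → (∀ k → k < n → f k ≡ g k) → sumBelow n f ≡ sumBelow n g
sumBelow-cong zero    f≗g = refl
sumBelow-cong (suc n) f≗g = cong₂ _+_ (f≗g 0 z<s) (sumBelow-cong n (λ k k<n → f≗g (suc k) (s<s k<n)))

sumBelow-zero : ∀ n {f : ℕ → ℕ} → (∀ k → k < n → f k ≡ 0) → sumBelow n f ≡ 0
sumBelow-zero zero    f≗0 = refl
sumBelow-zero (suc n) f≗0 = cong₂ _+_ (f≗0 0 z<s) (sumBelow-zero n (λ k k<n → f≗0 (suc k) (s<s k<n)))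

sumBelow-single : ∀ {n j} {f : ℕ → ℕ} → j < n → (∀ k → k < n → k ≢ j → f k ≡ 0) →
                  sumBelow n f ≡ f j
sumBelow-single {suc n} {zero} {f} _ vanish =
  trans (cong (f 0 +_) (sumBelow-zero n (λ k k<n → vanish (suc k) (s<s k<n) (λ ())))) (+-identityʳ (f 0))
sumBelow-single {suc n} {suc j} {f} (s≤s j<n) vanish =
  trans (cong (_+ sumBelow n (f ∘ suc)) (vanish 0 z<s (λ ())))
        (sumBelow-single j<n (λ k k<n k≢j → vanish (suc k) (s<s k<n) (k≢j ∘ suc-injective)))

sumBelow-pair : ∀ {n i j} {f : ℕ → ℕ} → i < j → j < n → (∀ k → k < n → k ≢ i → k ≢ j → f k ≡ 0) →
                sumBelow n f ≡ f i + f j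
sumBelow-pair {suc n} {zero} {suc j} {f} _ (s≤s j<n) vanish =
  cong (f 0 +_) (sumBelow-single j<n (λ k k<n k≢j → vanish (suc k) (s<s k<n) (λ ()) (k≢j ∘ suc-injective)))
sumBelow-pair {suc n} {suc i} {suc j} {f} (s≤s i<j) (s≤s j<n) vanish =
  trans (cong (_+ sumBelow n (f ∘ suc)) (vanish 0 z<s (λ ()) (λ ())))
        (sumBelow-pair i<j j<n
          (λ k k<n k≢i k≢j → vanish (suc k) (s<s k<n) (k≢i ∘ suc-injective) (k≢j ∘ suc-injective)))

sumBelow-+ : ∀ m n (f : ℕ → ℕ) → sumBelow (m + n) f ≡ sumBelow m f + sumBelow n (λ k → f (m + k))
sumBelow-+ zero    n f = refl
sumBelow-+ (suc m) n f = trans (cong (f 0 +_) (sumBelow-+ m n (f ∘ suc))) (sym (+-assoc (f 0) _ _))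

sum-tabulate : ∀ n (g : Fin n → ℕ) (f : ℕ → ℕ) → (∀ u → g u ≡ f (toℕ u)) →
               sum (tabulate g) ≡ sumBelow n f
sum-tabulate zero    g f g≗f = refl
sum-tabulate (suc n) g f g≗f =
  cong₂ _+_ (g≗f Fin.zero) (sum-tabulate n (g ∘ Fin.suc) (f ∘ suc) (g≗f ∘ Fin.suc))

previous : (ℕ → ℕ) → ℕ → ℕ
previous f zero    = 0
previous f (suc a) = f a

sumBelow-previous : ∀ {n a} {f : ℕ → ℕ} → a ≤ n → (∀ k → k < n → suc k ≢ a → f k ≡ 0) →
                    sumBelow n f ≡ previous f a
sumBelow-previous {n} {zero}  _   vanish = sumBelow-zero n (λ k k<n → vanish k k<n (λ ()))
sumBelow-previous {n} {suc b} b<n vanish = sumBelow-single b<n (λ k k<n k≢b → vanish k k<n (k≢b ∘ suc-injective))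

sumBelow-previous+ : ∀ {n a c} {f : ℕ → ℕ} → a ≤ c → c < n →
                     (∀ k → k < n → suc k ≢ a → k ≢ c → f k ≡ 0) →
                     sumBelow n f ≡ previous f a + f c
sumBelow-previous+ {a = zero}  _   c<n vanish = sumBelow-single c<n (λ k k<n → vanish k k<n (λ ()))
sumBelow-previous+ {a = suc b} b<c c<n vanish =
  sumBelow-pair b<c c<n (λ k k<n k≢b → vanish k k<n (k≢b ∘ suc-injective))

∣-previous : ∀ {g n a} {R : ℕ → ℕ} → (∀ k → k < n → g ∣ R k) → a ≤ n → g ∣ previous R a
∣-previous {g} {a = zero}  _   _   = g ∣0
∣-previous {a = suc b} g∣R b<n = g∣R b b<n

at-fromℕ< : ∀ {n} (f : Fin n → ℕ) {k} (k<n : k < n) → at f k ≡ f (fromℕ< k<n)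
at-fromℕ< {n} f {k} k<n with k <? n
... | yes _   = refl
... | no k≮n = contradiction k<n k≮n

at-toℕ : ∀ {n} (f : Fin n → ℕ) u → at f (toℕ u) ≡ f u
at-toℕ f u = trans (at-fromℕ< f (toℕ<n u)) (cong f (fromℕ<-toℕ u _))

at-≥ : ∀ {n} (f : Fin n → ℕ) {k} → n ≤ k → at f k ≡ 0
at-≥ {n} f {k} n≤k with k <? n
... | yes k<n = contradiction n≤k (<⇒≱ k<n)
... | no _    = refl

at-lift : ∀ {n} (P : ℕ → Set) {f : Fin n → ℕ} {g : ℕ → ℕ} →
          (∀ u → P (toℕ u) → f u ≡ g (toℕ u)) → (∀ k → n ≤ k → P k → g k ≡ 0) →
          ∀ k → P k → at f k ≡ g k
at-lift {n} P {f} {g} inside outside k Pk with k <? n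
... | yes k<n = trans (inside (fromℕ< k<n) (subst P (sym (toℕ-fromℕ< k<n)) Pk)) (cong g (toℕ-fromℕ< k<n))
... | no k≮n = sym (outside k (≮⇒≥ k≮n) Pk)

at-∀ : ∀ {n} {P : ℕ → Set} {f : Fin n → ℕ} → (∀ u → P (f u)) → ∀ k → k < n → P (at f k)
at-∀ {P = P} {f} Pf k k<n = subst P (sym (at-fromℕ< f k<n)) (Pf (fromℕ< k<n))

∀-at : ∀ {n} {P : ℕ → Set} {f : Fin n → ℕ} → (∀ k → k < n → P (at f k)) → ∀ u → P (f u)
∀-at {P = P} {f} Pf u = subst P (at-toℕ f u) (Pf (toℕ u) (toℕ<n u))

gcdAll-∣ : ∀ {n} (f : Fin n → ℕ) u → gcdAll f ∣ f u
gcdAll-∣ {n} f u = go (allFin n) (∈-allFin u)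
  where
  go : ∀ us → u ∈ us → foldr (λ v g → gcd (f v) g) 0 us ∣ f u
  go (v ∷ us) (here refl) = gcd[m,n]∣m (f v) _
  go (v ∷ us) (there u∈us) = ∣-trans (gcd[m,n]∣n (f v) _) (go us u∈us)

gcdAll-greatest : ∀ {n} {f : Fin n → ℕ} {g} → (∀ u → g ∣ f u) → g ∣ gcdAll f
gcdAll-greatest {n} {f} {g} g∣f = go (allFin n)
  where
  go : ∀ us → g ∣ foldr (λ v g → gcd (f v) g) 0 us
  go []       = g ∣0
  go (v ∷ us) = gcd-greatest (g∣f v) (go us)

-- Vertices of CT(suc h, s) by their 0-based index: the path is 0, …, h with hub h, and leaf j is
-- suc h + j. Edge h a b is an edge read in the direction in which ctAdj₀ (suc h) a b detects it.
data Edge (h : ℕ) : ℕ → ℕ → Set where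
  step  : ∀ {a} → a < h → Edge h a (suc a)
  spoke : ∀ {b} → h < b → Edge h h b

ctAdj₀⇒Edge : ∀ {h a b} → T (ctAdj₀ (suc h) a b) → Edge h a b
ctAdj₀⇒Edge {h} {a} {b} t with to (T-∨ {⌊ suc a ≟ b ⌋ ∧ ⌊ b <? suc h ⌋}) t
... | inj₁ t₁ = let e , lt = to (T-∧ {⌊ suc a ≟ b ⌋}) t₁ in step′ (toWitness e) (toWitness lt)
  where
  step′ : suc a ≡ b → b < suc h → Edge h a b
  step′ refl (s≤s a<h) = step a<h
... | inj₂ t₂ = let e , le = to (T-∧ {⌊ suc a ≟ suc h ⌋}) t₂ in spoke′ (toWitness e) (toWitness le)
  where
  spoke′ : suc a ≡ suc h → suc h ≤ b → Edge h a b
  spoke′ refl h<b = spoke h<b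

Edge⇒ctAdj₀ : ∀ {h a b} → Edge h a b → T (ctAdj₀ (suc h) a b)
Edge⇒ctAdj₀ {h} {a} (step a<h) =
  from T-∨ (inj₁ (from T-∧ (fromWitness {a? = suc a ≟ suc a} refl , fromWitness (s≤s a<h))))
Edge⇒ctAdj₀ {h} {b = b} (spoke h<b) =
  from (T-∨ {⌊ suc h ≟ b ⌋ ∧ ⌊ b <? suc h ⌋})
       (inj₂ (from T-∧ (fromWitness {a? = suc h ≟ suc h} refl , fromWitness h<b)))

Adjacent : ℕ → ℕ → ℕ → Set
Adjacent h a b = Edge h a b ⊎ Edge h b a

incident : ℕ → (ℕ → ℕ) → ℕ → ℕ → ℕ
incident h R a k = if ctAdj₀ (suc h) a k ∨ ctAdj₀ (suc h) k a then R k else 0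

Adjacent⇒T : ∀ {h a k} → Adjacent h a k → T (ctAdj₀ (suc h) a k ∨ ctAdj₀ (suc h) k a)
Adjacent⇒T {h} {a} {k} = from (T-∨ {ctAdj₀ (suc h) a k}) ∘ Sum.map Edge⇒ctAdj₀ Edge⇒ctAdj₀

T⇒Adjacent : ∀ {h a k} → T (ctAdj₀ (suc h) a k ∨ ctAdj₀ (suc h) k a) → Adjacent h a k
T⇒Adjacent {h} {a} {k} = Sum.map ctAdj₀⇒Edge ctAdj₀⇒Edge ∘ to (T-∨ {ctAdj₀ (suc h) a k})

if-T : ∀ {b} {x : ℕ} → T b → (if b then x else 0) ≡ x
if-T {true} _ = refl

if-¬T : ∀ {b} {x : ℕ} → ¬ T b → (if b then x else 0) ≡ 0
if-¬T {false} _  = refl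
if-¬T {true}  ¬t = contradiction tt ¬t

incident-adjacent : ∀ {h a k} R → Adjacent h a k → incident h R a k ≡ R k
incident-adjacent R = if-T ∘ Adjacent⇒T

incident-nonadjacent : ∀ {h a k} R → ¬ Adjacent h a k → incident h R a k ≡ 0
incident-nonadjacent R ¬adj = if-¬T (¬adj ∘ T⇒Adjacent)

incident-previous : ∀ {h a} R → a ≤ h → previous (incident h R a) a ≡ previous R a
incident-previous {a = zero}  R _   = refl
incident-previous {a = suc b} R b<h = incident-adjacent R (inj₂ (step b<h))

path-adjacent : ∀ {h a k} → a < h → Adjacent h a k → k ≡ suc a ⊎ suc k ≡ a
path-adjacent _   (inj₁ (step _))    = inj₁ refl
path-adjacent h<h (inj₁ (spoke _))   = contradiction h<h (<-irrefl refl)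
path-adjacent _   (inj₂ (step _))    = inj₂ refl
path-adjacent a<h (inj₂ (spoke h<a)) = contradiction a<h (<-asym h<a)

hub-adjacent : ∀ {h k} → Adjacent h h k → h < k ⊎ suc k ≡ h
hub-adjacent (inj₁ (step h<h))  = contradiction h<h (<-irrefl refl)
hub-adjacent (inj₁ (spoke h<k)) = inj₁ h<k
hub-adjacent (inj₂ (step _))    = inj₂ refl
hub-adjacent (inj₂ (spoke h<h)) = contradiction h<h (<-irrefl refl)

leaf-adjacent : ∀ {h a k} → h < a → Adjacent h a k → k ≡ h
leaf-adjacent h<a (inj₁ (step a<h))  = contradiction a<h (<-asym h<a)
leaf-adjacent h<h (inj₁ (spoke _))   = contradiction h<h (<-irrefl refl)
leaf-adjacent h<k+1 (inj₂ (step k<h)) = contradiction (m<1+n⇒m≤n h<k+1) (<⇒≱ k<h)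
leaf-adjacent _   (inj₂ (spoke _))   = refl

data Vertex (h s : ℕ) : ℕ → Set where
  path : ∀ {a} → a < h → Vertex h s a
  hub  : Vertex h s h
  leaf : ∀ {j} → j < s → Vertex h s (suc h + j)

shift : ∀ {h s a} → Vertex h s a → Vertex (suc h) s (suc a)
shift (path a<h) = path (s<s a<h)
shift hub        = hub
shift (leaf j<s) = leaf j<s

vertex : ∀ {h s a} → a < suc h + s → Vertex h s a
vertex {zero}  {a = zero}  _           = hub
vertex {zero}  {a = suc a} (s≤s a<s)   = leaf a<s
vertex {suc h} {a = zero}  _           = path z<s
vertex {suc h} {a = suc a} (s≤s a<h+s) = shift (vertex a<h+s)

Vertex⇒< : ∀ {h s a} → Vertex h s a → a < suc h + s
Vertex⇒< {h} {s} (path a<h) = m<n⇒m<1+n (≤-trans a<h (m≤m+n h s))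
Vertex⇒< {h} {s} hub        = s≤s (m≤m+n h s)
Vertex⇒< {h} {s} (leaf j<s) = +-monoʳ-< (suc h) j<s

leafSum : ℕ → ℕ → (ℕ → ℕ) → ℕ
leafSum h s R = sumBelow s (λ j → R (suc h + j))

neighbourTotal : ∀ {h s a} → (ℕ → ℕ) → Vertex h s a → ℕ
neighbourTotal {a = a} R (path _) = previous R a + R (suc a)
neighbourTotal {h} {s} R hub      = previous R h + leafSum h s R
neighbourTotal {h} R (leaf _)     = R h

sumBelow-incident : ∀ {h s a} (R : ℕ → ℕ) (v : Vertex h s a) →
               sumBelow (suc h + s) (incident h R a) ≡ neighbourTotal R v
sumBelow-incident {h} {s} {a} R (path a<h) =
  trans (sumBelow-previous+ (n≤1+n a) (s≤s (≤-trans a<h (m≤m+n h s))) vanish)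
        (cong₂ _+_ (incident-previous R (<⇒≤ a<h)) (incident-adjacent R (inj₁ (step a<h))))
  where
  vanish : ∀ k → k < suc h + s → suc k ≢ a → k ≢ suc a → incident h R a k ≡ 0
  vanish k _ k+1≢a k≢a+1 = incident-nonadjacent R ([ k≢a+1 , k+1≢a ] ∘ path-adjacent a<h)
sumBelow-incident {h} {s} R hub =
  trans (sumBelow-+ (suc h) s (incident h R h))
        (cong₂ _+_ (trans (sumBelow-previous (n≤1+n h) vanish) (incident-previous {h} R ≤-refl))
                   (sumBelow-cong s (λ j _ → incident-adjacent R (inj₁ (spoke (s≤s (m≤m+n h j)))))))
  where
  vanish : ∀ k → k < suc h → suc k ≢ h → incident h R h k ≡ 0
  vanish k k≤h k+1≢h =
    incident-nonadjacent R ([ (λ h<k → <⇒≱ h<k (m<1+n⇒m≤n k≤h)) , k+1≢h ] ∘ hub-adjacent)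
sumBelow-incident {h} {s} R (leaf {j} _) =
  trans (sumBelow-single (s≤s (m≤m+n h s)) (λ k _ k≢h → incident-nonadjacent R (k≢h ∘ leaf-adjacent h<a)))
        (incident-adjacent R (inj₂ (spoke h<a)))
  where
  h<a : h < suc h + j
  h<a = s≤s (m≤m+n h j)

neighbourSum-CT : ∀ {h s} (r : Fin (suc h + s) → ℕ) v {a} (x : Vertex h s a) → toℕ v ≡ a →
                  neighbourSum (CT (suc h) s) r v ≡ neighbourTotal (at r) x
neighbourSum-CT {h} {s} r v x refl = begin
  neighbourSum (CT (suc h) s) r v
    ≡⟨ cong sum (map-tabulate id (λ u → if CT (suc h) s v u then r u else 0)) ⟩
  sum (tabulate (λ u → if CT (suc h) s v u then r u else 0))
    ≡⟨ sum-tabulate _ _ (incident h (at r) (toℕ v))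
                    (λ u → cong (if CT (suc h) s v u then_else 0) (sym (at-toℕ r u))) ⟩
  sumBelow (suc h + s) (incident h (at r) (toℕ v))
    ≡⟨ sumBelow-incident (at r) x ⟩
  neighbourTotal (at r) x ∎
  where open ≡-Reasoning

Balanced : ℕ → ℕ → (ℕ → ℕ) → (ℕ → ℕ) → Set
Balanced h s D R = ∀ {a} (v : Vertex h s a) → D a * R a ≡ neighbourTotal R v

balance⇒Balanced : ∀ {h s} {d r : Fin (suc h + s) → ℕ} →
                   (∀ v → d v * r v ≡ neighbourSum (CT (suc h) s) r v) → Balanced h s (at d) (at r)
balance⇒Balanced {h} {s} {d} {r} balance {a} x = begin
  at d a * at r a                  ≡⟨ cong₂ _*_ (at-fromℕ< d a<n) (at-fromℕ< r a<n) ⟩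
  d v * r v                        ≡⟨ balance v ⟩
  neighbourSum (CT (suc h) s) r v  ≡⟨ neighbourSum-CT r v x (toℕ-fromℕ< a<n) ⟩
  neighbourTotal (at r) x          ∎
  where
  open ≡-Reasoning
  a<n = Vertex⇒< x
  v = fromℕ< a<n

Balanced⇒balance : ∀ {h s} {d r : Fin (suc h + s) → ℕ} →
                   Balanced h s (at d) (at r) → ∀ v → d v * r v ≡ neighbourSum (CT (suc h) s) r v
Balanced⇒balance {h} {s} {d} {r} balanced v = begin
  d v * r v                        ≡⟨ cong₂ _*_ (at-toℕ d v) (at-toℕ r v) ⟨
  at d (toℕ v) * at r (toℕ v)      ≡⟨ balanced x ⟩
  neighbourTotal (at r) x          ≡⟨ neighbourSum-CT r v x refl ⟨
  neighbourSum (CT (suc h) s) r v  ∎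
  where
  open ≡-Reasoning
  x = vertex (toℕ<n v)

neighbourTotal-positive : ∀ {h s a} {R : ℕ → ℕ} → 1 ≤ s → (∀ k → k < suc h + s → 1 ≤ R k) →
                          (v : Vertex h s a) → 1 ≤ neighbourTotal R v
neighbourTotal-positive {h} {s} {a} {R} _ R>0 (path a<h) =
  ≤-trans (R>0 _ (s≤s (≤-trans a<h (m≤m+n h s)))) (m≤n+m _ (previous R a))
neighbourTotal-positive {h} {suc s} {R = R} _ R>0 hub =
  ≤-trans (R>0 _ (+-monoʳ-< (suc h) z<s))
          (≤-trans (m≤m+n (R (suc h + 0)) (sumBelow s (λ j → R (suc h + suc j)))) (m≤n+m _ (previous R h)))
neighbourTotal-positive {h} {s} _ R>0 (leaf _) = R>0 h (s≤s (m≤m+n h s))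

Balanced⇒D-positive : ∀ {h s} {D R : ℕ → ℕ} → 1 ≤ s → Balanced h s D R →
                      (∀ k → k < suc h + s → 1 ≤ R k) → ∀ k → k < suc h + s → 1 ≤ D k
Balanced⇒D-positive {D = D} {R} 1≤s balanced R>0 k k<n =
  >-nonZero⁻¹ (D k) {{m*n≢0⇒m≢0 (D k) {{>-nonZero DR>0}}}}
  where
  DR>0 : 1 ≤ D k * R k
  DR>0 = subst (1 ≤_) (sym (balanced (vertex k<n))) (neighbourTotal-positive 1≤s R>0 (vertex k<n))

record IsSmoothingAt (i : ℕ) (D R D′ R′ : ℕ → ℕ) : Set where
  field
    r-below  : ∀ k → k < i → R′ k ≡ R k
    r-above  : ∀ k → i ≤ k → R′ k ≡ R (suc k)
    d-below  : ∀ k → suc k < i → D′ k ≡ D k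
    d-before : ∀ k → suc k ≡ i → D′ k ≡ D k ∸ 1
    d-at     : D′ i ≡ D (suc i) ∸ 1
    d-above  : ∀ k → i < k → D′ k ≡ D (suc k)

-- Both sides are 0 outside the index range, so the relations hold for every k.
smooth-isSmoothingAt : ∀ {p s i} (d r : Fin (suc p + s) → ℕ) → i < p + s →
  IsSmoothingAt i (at d) (at r) (at (smoothD (suc p) s i d)) (at (smoothR (suc p) s i r))
smooth-isSmoothingAt {p} {s} {i} d r i<n = record
  { r-below  = at-lift (_< i) r-below (λ k n≤k k<i → beyond n≤k (<⇒≤ k<i))
  ; r-above  = at-lift (i ≤_) r-above (λ k n≤k _ → at-≥ r (s≤s n≤k))
  ; d-below  = at-lift (λ k → suc k < i) d-below (λ k n≤k k+1<i → beyond n≤k (≤-trans (n≤1+n k) (<⇒≤ k+1<i)))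
  ; d-before = at-lift (λ k → suc k ≡ i) d-before (λ { k n≤k refl → beyond n≤k (n≤1+n k) })
  ; d-at     = at-lift (_≡ i) d-at (λ { k n≤k refl → beyond n≤k ≤-refl }) i refl
  ; d-above  = at-lift (i <_) d-above (λ k n≤k _ → at-≥ d (s≤s n≤k))
  }
  where
  beyond : ∀ {k A} → p + s ≤ k → k ≤ i → A
  beyond n≤k k≤i = contradiction (≤-trans n≤k k≤i) (<⇒≱ i<n)

  r-below : ∀ u → toℕ u < i → smoothR (suc p) s i r u ≡ at r (toℕ u)
  r-below u u<i with toℕ u <? i
  ... | yes _   = refl
  ... | no u≮i = contradiction u<i u≮i

  r-above : ∀ u → i ≤ toℕ u → smoothR (suc p) s i r u ≡ at r (suc (toℕ u))
  r-above u i≤u with toℕ u <? i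
  ... | yes u<i = contradiction i≤u (<⇒≱ u<i)
  ... | no _    = refl

  d-below : ∀ u → suc (toℕ u) < i → smoothD (suc p) s i d u ≡ at d (toℕ u)
  d-below u u+1<i with suc (toℕ u) <? i
  ... | yes _       = refl
  ... | no u+1≮i    = contradiction u+1<i u+1≮i

  d-before : ∀ u → suc (toℕ u) ≡ i → smoothD (suc p) s i d u ≡ at d (toℕ u) ∸ 1
  d-before u u+1≡i with suc (toℕ u) <? i | suc (toℕ u) ≟ i
  ... | yes u+1<i | _        = contradiction u+1≡i (<⇒≢ u+1<i)
  ... | no _      | yes _    = refl
  ... | no _      | no u+1≢i = contradiction u+1≡i u+1≢i

  d-at : ∀ u → toℕ u ≡ i → smoothD (suc p) s i d u ≡ at d (suc (toℕ u)) ∸ 1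
  d-at u refl with suc (toℕ u) <? toℕ u | suc (toℕ u) ≟ toℕ u | toℕ u ≟ toℕ u
  ... | yes u+1<u | _        | _     = contradiction u+1<u (<-asym (n<1+n _))
  ... | no _      | yes u+1≡u | _    = contradiction u+1≡u (>⇒≢ (n<1+n _))
  ... | no _      | no _     | yes _ = refl
  ... | no _      | no _     | no u≢u = contradiction refl u≢u

  d-above : ∀ u → i < toℕ u → smoothD (suc p) s i d u ≡ at d (suc (toℕ u))
  d-above u i<u with suc (toℕ u) <? i | suc (toℕ u) ≟ i | toℕ u ≟ i
  ... | yes u+1<i | _         | _       = contradiction (<-trans i<u (n<1+n _)) (<-asym u+1<i)
  ... | no _      | yes u+1≡i | _       = contradiction (<-trans i<u (n<1+n _)) (<-irrefl (sym u+1≡i))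
  ... | no _      | no _      | yes u≡i = contradiction i<u (<-irrefl (sym u≡i))
  ... | no _      | no _      | no _    = refl

smoothing-∀ : ∀ {i n} {D R D′ R′ : ℕ → ℕ} {P : ℕ → Set} → IsSmoothingAt i D R D′ R′ →
              (∀ k → k < suc n → P (R k)) → ∀ k → k < n → P (R′ k)
smoothing-∀ {i} {P = P} σ PR k k<n with k <? i
... | yes k<i = subst P (sym (IsSmoothingAt.r-below σ k k<i)) (PR k (m<n⇒m<1+n k<n))
... | no k≮i  = subst P (sym (IsSmoothingAt.r-above σ k (≮⇒≥ k≮i))) (PR (suc k) (s<s k<n))

m*n≡a+n+b⇒[m∸1]*n≡a+b : ∀ m n a b → m * n ≡ a + n + b → (m ∸ 1) * n ≡ a + b
m*n≡a+n+b⇒[m∸1]*n≡a+b m n a b eq = begin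
  (m ∸ 1) * n    ≡⟨ *-distribʳ-∸ n m 1 ⟩
  m * n ∸ 1 * n  ≡⟨ cong₂ _∸_ eq (*-identityˡ n) ⟩
  a + n + b ∸ n  ≡⟨ cong (_∸ n) (xy∙z≈xz∙y a n b) ⟩
  a + b + n ∸ n  ≡⟨ m+n∸n≡m (a + b) n ⟩
  a + b          ∎
  where open ≡-Reasoning

module Smoothing {h s i} {D R D′ R′ : ℕ → ℕ} (balanced : Balanced (suc h) s D R) (i≤h : i ≤ h)
                 (Dᵢ≡1 : D i ≡ 1) (σ : IsSmoothingAt i D R D′ R′) where
  open IsSmoothingAt σ

  R-removed : R i ≡ previous R i + R (suc i)
  R-removed = begin
    R i          ≡⟨ *-identityˡ (R i) ⟨
    1 * R i      ≡⟨ cong (_* R i) Dᵢ≡1 ⟨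
    D i * R i    ≡⟨ balanced (path (s≤s i≤h)) ⟩
    previous R i + R (suc i) ∎
    where open ≡-Reasoning

  previous-below : ∀ {a} → a ≤ i → previous R′ a ≡ previous R a
  previous-below {zero}  _   = refl
  previous-below {suc b} b<i = r-below b b<i

  previous-above : ∀ {a} → i < a → previous R′ a ≡ R a
  previous-above {suc b} i≤b = r-above b (m<1+n⇒m≤n i≤b)

  leafSum-smoothed : leafSum h s R′ ≡ leafSum (suc h) s R
  leafSum-smoothed = sumBelow-cong s (λ j _ → r-above (suc h + j) (≤-trans i≤h (m≤n⇒m≤1+n (m≤m+n h j))))

  unchanged : ∀ {a} → suc a < i → D′ a * R′ a ≡ previous R′ a + R′ (suc a)
  unchanged {a} a+1<i = begin
    D′ a * R′ a                 ≡⟨ cong₂ _*_ (d-below a a+1<i) (r-below a a<i) ⟩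
    D a * R a                   ≡⟨ balanced (path (<-≤-trans a<i (m≤n⇒m≤1+n i≤h))) ⟩
    previous R a + R (suc a)    ≡⟨ cong₂ _+_ (previous-below (<⇒≤ a<i)) (r-below (suc a) a+1<i) ⟨
    previous R′ a + R′ (suc a)  ∎
    where
    open ≡-Reasoning
    a<i = <-trans (n<1+n a) a+1<i

  left-of-removed : ∀ {a} → suc a ≡ i → D′ a * R′ a ≡ previous R′ a + R′ (suc a)
  left-of-removed {a} refl = begin
    D′ a * R′ a                       ≡⟨ cong₂ _*_ (d-before a refl) (r-below a ≤-refl) ⟩
    (D a ∸ 1) * R a                   ≡⟨ m*n≡a+n+b⇒[m∸1]*n≡a+b (D a) (R a) (previous R a) (R (suc (suc a))) eq ⟩
    previous R a + R (suc (suc a))    ≡⟨ cong₂ _+_ (previous-below (n≤1+n a)) (r-above (suc a) ≤-refl) ⟨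
    previous R′ a + R′ (suc a)        ∎
    where
    open ≡-Reasoning
    eq : D a * R a ≡ previous R a + R a + R (suc (suc a))
    eq = trans (balanced (path (m≤n⇒m≤1+n i≤h)))
               (trans (cong (previous R a +_) R-removed) (sym (+-assoc (previous R a) (R a) (R (suc (suc a))))))

  right-of-removed : ∀ X → D (suc i) * R (suc i) ≡ R i + X → D′ i * R′ i ≡ previous R′ i + X
  right-of-removed X eq = begin
    D′ i * R′ i                ≡⟨ cong₂ _*_ d-at (r-above i ≤-refl) ⟩
    (D (suc i) ∸ 1) * R (suc i) ≡⟨ m*n≡a+n+b⇒[m∸1]*n≡a+b (D (suc i)) (R (suc i)) (previous R i) X eq′ ⟩
    previous R i + X           ≡⟨ cong (_+ X) (previous-below ≤-refl) ⟨
    previous R′ i + X          ∎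
    where
    open ≡-Reasoning
    eq′ : D (suc i) * R (suc i) ≡ previous R i + R (suc i) + X
    eq′ = trans eq (cong (_+ X) R-removed)

  at-removed : ∀ {a} → a ≡ i → (v : Vertex h s a) → D′ a * R′ a ≡ neighbourTotal R′ v
  at-removed refl (path i<h) =
    trans (right-of-removed (R (suc (suc i))) (balanced (path (s<s i<h))))
          (cong (previous R′ i +_) (sym (r-above (suc i) (n≤1+n i))))
  at-removed refl hub =
    trans (right-of-removed (leafSum (suc h) s R) (balanced hub)) (cong (previous R′ h +_) (sym leafSum-smoothed))
  at-removed refl (leaf _) = contradiction i≤h (<⇒≱ (s≤s (m≤m+n h _)))

  shifted : ∀ {a} → i < a → (v : Vertex h s a) → D′ a * R′ a ≡ neighbourTotal R′ v
  shifted {a} i<a v = begin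
    D′ a * R′ a                       ≡⟨ cong₂ _*_ (d-above a i<a) (r-above a (<⇒≤ i<a)) ⟩
    D (suc a) * R (suc a)             ≡⟨ balanced (shift v) ⟩
    neighbourTotal R (shift v)        ≡⟨ shift-neighbourTotal v ⟩
    neighbourTotal R′ v               ∎
    where
    open ≡-Reasoning
    shift-neighbourTotal : (v : Vertex h s a) → neighbourTotal R (shift v) ≡ neighbourTotal R′ v
    shift-neighbourTotal (path _) = sym (cong₂ _+_ (previous-above i<a) (r-above (suc a) (m≤n⇒m≤1+n (<⇒≤ i<a))))
    shift-neighbourTotal hub      = sym (cong₂ _+_ (previous-above i<a) leafSum-smoothed)
    shift-neighbourTotal (leaf _) = sym (r-above h i≤h)

  before-removed : ∀ {a} → a < i → (v : Vertex h s a) → D′ a * R′ a ≡ neighbourTotal R′ v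
  before-removed a<i (path _) with m≤n⇒m<n∨m≡n a<i
  ... | inj₁ a+1<i = unchanged a+1<i
  ... | inj₂ a+1≡i = left-of-removed a+1≡i
  before-removed h<i hub      = contradiction i≤h (<⇒≱ h<i)
  before-removed a<i (leaf _) = contradiction i≤h (<⇒≱ (<-trans (s≤s (m≤m+n h _)) a<i))

  balanced′ : Balanced h s D′ R′
  balanced′ {a} v with <-cmp a i
  ... | tri< a<i _ _ = before-removed a<i v
  ... | tri≈ _ a≡i _ = at-removed a≡i v
  ... | tri> _ _ i<a = shifted i<a v

  R-removed-smoothed : R i ≡ previous R′ i + R′ i
  R-removed-smoothed = trans R-removed (sym (cong₂ _+_ (previous-below ≤-refl) (r-above i ≤-refl)))

  i<n′ : i < suc h + s
  i<n′ = s≤s (≤-trans i≤h (m≤m+n h s))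

  ∣R′⇒∣R : ∀ {g} → (∀ k → k < suc h + s → g ∣ R′ k) → ∀ k → k < suc (suc h) + s → g ∣ R k
  ∣R′⇒∣R {g} g∣R′ k k<n with <-cmp k i
  ... | tri< k<i _ _  = subst (g ∣_) (r-below k k<i) (g∣R′ k (<-trans k<i i<n′))
  ... | tri≈ _ refl _ =
    subst (g ∣_) (sym R-removed-smoothed) (∣m∣n⇒∣m+n (∣-previous g∣R′ (<⇒≤ i<n′)) (g∣R′ i i<n′))
  ... | tri> _ _ i<k  = ∣R-above i<k k<n
    where
    ∣R-above : ∀ {k} → i < k → k < suc (suc h) + s → g ∣ R k
    ∣R-above {suc b} (s≤s i≤b) (s≤s b<n) = subst (g ∣_) (r-above b i≤b) (g∣R′ b b<n)

proposition3p3 : (p s : ℕ) → 2 ≤ p → 1 ≤ s →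
    (d r : Fin (p + s) → ℕ) → IsArithmetical (CT p s) d r →
    (i : ℕ) → i < pred p → at d i ≡ 1 →
    IsArithmetical (CT (pred p) s) (smoothD p s i d) (smoothR p s i r)
proposition3p3 (suc (suc h)) (suc s) _ _ d r A i (s≤s i≤h) dᵢ≡1 = record
  { d-pos   = ∀-at {P = 1 ≤_} (Balanced⇒D-positive (s≤s z≤n) balanced′ R′-positive)
  ; r-pos   = ∀-at {P = 1 ≤_} R′-positive
  ; balance = Balanced⇒balance balanced′
  ; r-gcd   = ∣1⇒≡1 (subst (g′ ∣_) r-gcd
                      (gcdAll-greatest (∀-at {P = g′ ∣_} (∣R′⇒∣R (at-∀ {P = g′ ∣_} (gcdAll-∣ r′))))))
  }
  where
  open IsArithmetical A
  r′ : Fin (suc h + suc s) → ℕ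
  r′ = smoothR (suc (suc h)) (suc s) i r
  g′ : ℕ
  g′ = gcdAll r′
  σ : IsSmoothingAt i (at d) (at r) (at (smoothD (suc (suc h)) (suc s) i d)) (at r′)
  σ = smooth-isSmoothingAt {suc h} d r (≤-trans (s≤s i≤h) (m≤m+n (suc h) (suc s)))
  open Smoothing (balance⇒Balanced {d = d} balance) i≤h dᵢ≡1 σ
  R′-positive : ∀ k → k < suc h + suc s → 1 ≤ at r′ k
  R′-positive = smoothing-∀ {P = 1 ≤_} σ (at-∀ {P = 1 ≤_} r-pos)
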